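{- Let $F$ be a graph and let $\mathcal{H}$ be an $F$-free hypergraph on $n$ vertices. If every hyperedge of $\mathcal{H}$ has size at least $|V(F)|$, then $|\mathcal{H}|\le \mathrm{ex}(n,F)$.
   Context: Hypergraphs are finite and may contain multi-hyperedges; $|\mathcal{H}|$ is the number of hyperedges (counted with multiplicity). For a graph $G$, a hypergraph $\mathcal{B}$ is a Berge-$G$ if there is a bijection $f:E(G)\to E(\mathcal{B})$ with $e\subseteq f(e)$ for every $e\in E(G)$ (vertices of $G$ identified with distinct vertices of the hypergraph). A hypergraph is $G$-free if no subfamily of its hyperedges is a Berge-$G$. $\mathrm{ex}(n,F)$ is the maximum number of edges of an $F$-free simple graph on $n$ vertices. -}

module Defs where

open import Data.Nat using (ℕ; _<_; _≤_)
open import Data.Fin using (Fin; toℕ)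
open import Data.Fin.Subset using (Subset; _∈_; ∣_∣)
open import Data.List using (List; length; lookup)
open import Data.List.Relation.Unary.All using (All)
open import Data.List.Relation.Unary.Unique.Propositional using (Unique)
open import Data.List.Membership.Propositional renaming (_∈_ to _∈ₗ_)
open import Data.Product using (Σ; _×_; _,_; proj₁; proj₂)
open import Data.Sum using (_⊎_)
open import Function.Definitions using (Injective)
open import Relation.Binary.PropositionalEquality using (_≡_)
open import Relation.Nullary using (¬_)

-- A finite simple graph on vertex set Fin v: a duplicate-free list of edges,
-- each edge a pair (i , j) with i < j (so no loops, each unordered pair once).
record Graph (v : ℕ) : Set where
  field
    edges    : List (Fin v × Fin v)
    ordered  : All (λ e → toℕ (proj₁ e) < toℕ (proj₂ e)) edges
    distinct : Unique edges
open Graph public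

e : ∀ {v} → Graph v → ℕ
e G = length (edges G)

Adj : ∀ {v} → Graph v → Fin v → Fin v → Set
Adj G a b = ((a , b) ∈ₗ edges G) ⊎ ((b , a) ∈ₗ edges G)

ContainsCopy : ∀ {k n} → Graph n → Graph k → Set
ContainsCopy {k} {n} G F =
  Σ (Fin k → Fin n) λ φ →
    Injective _≡_ _≡_ φ ×
    All (λ ab → Adj G (φ (proj₁ ab)) (φ (proj₂ ab))) (edges F)

FFree : ∀ {k n} → Graph k → Graph n → Set
FFree F G = ¬ ContainsCopy G F

-- A hypergraph on vertex set Fin n, possibly with repeated hyperedges:
-- a list of hyperedges, each a subset of Fin n. |H| = length.
Hypergraph : ℕ → Set
Hypergraph n = List (Subset n)

-- H contains a Berge-F: an injective vertex map φ and an injective map g from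
-- the edges of F to (indices of) hyperedges of H, with each edge ab of F
-- satisfying {φ a, φ b} ⊆ g(ab).  (g is a bijection onto the subfamily it picks.)
ContainsBerge : ∀ {k n} → Hypergraph n → Graph k → Set
ContainsBerge {k} {n} H F =
  Σ (Fin k → Fin n) λ φ →
  Σ (Fin (length (edges F)) → Fin (length H)) λ g →
    Injective _≡_ _≡_ φ ×
    Injective _≡_ _≡_ g ×
    (∀ i → let ab = lookup (edges F) i in
           (φ (proj₁ ab) ∈ lookup H (g i)) × (φ (proj₂ ab) ∈ lookup H (g i)))

BergeFree : ∀ {k n} → Graph k → Hypergraph n → Set
BergeFree F H = ¬ ContainsBerge H F

-- m ≤ ex(n,F)  iff  some F-free simple graph on n vertices has at least m edges.
_≤ex[_,_] : ℕ → (n : ℕ) → ∀ {k} → Graph k → Set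
m ≤ex[ n , F ] = Σ (Graph n) λ G → FFree F G × m ≤ e G

-- Idea: choose for every hyperedge h a pair of vertices of h ("its
-- representative") so that distinct hyperedges get distinct pairs.  The
-- representative pairs form a simple graph G with exactly |H| edges, and
-- every copy of F in G lifts to a Berge-F in H by sending each edge to the
-- hyperedge it represents.  Hence G is F-free, so |H| = e(G) ≤ ex(n,F).
--
-- The representatives are chosen greedily along the list of hyperedges.
-- When the next hyperedge h is reached, either some pair inside h is not yet
-- an edge of G (take it), or h is a clique of G on at least k vertices; then
-- G contains F, so the hyperedges seen so far already contain a Berge-F,
-- which is impossible.

module Submission where

open import Defs
open import Data.Nat using (ℕ; _≤_)
open import Data.List using (length)
open import Data.List.Relation.Unary.All using (All)
open import Data.Fin.Subset using (∣_∣)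

open import Data.Nat.Properties using (≤-reflexive)
open import Data.Fin using (Fin; _<_; inject≤) renaming (zero to fzero; suc to fsuc)
open import Data.Fin.Properties using (suc-injective; inject≤-injective; any?; _<?_; <-cmp; <-asym; <-irrefl)
  renaming (_≟_ to _≟ᶠ_)
open import Data.Fin.Subset using (Subset; inside; outside; _∈_)
open import Data.Fin.Subset.Properties using () renaming (_∈?_ to _∈ˢ?_)
open import Data.Vec.Base using (here; there; _∷_)
open import Data.List using (List; []; _∷_; lookup)
open import Data.List.Relation.Unary.All using ([]; _∷_)
import Data.List.Relation.Unary.All as All
open import Data.List.Relation.Unary.All.Properties.Core using (¬Any⇒All¬)
open import Data.List.Relation.Unary.Any using (here; there)
open import Data.List.Relation.Unary.Unique.Propositional using (Unique)
open import Data.List.Relation.Unary.AllPairs using ([]; _∷_)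
open import Data.List.Relation.Binary.Pointwise using (Pointwise; []; _∷_; Pointwise-length)
open import Data.List.Membership.Propositional using () renaming (_∈_ to _∈ₗ_)
open import Data.List.Membership.Propositional.Properties using (∈-lookup)
open import Data.List.Membership.DecPropositional using () renaming (_∈?_ to member?)
open import Data.Product using (Σ; ∃; _×_; _,_; proj₁; proj₂)
open import Data.Product.Properties using (≡-dec)
open import Data.Sum using (_⊎_; inj₁; inj₂)
open import Data.Empty using (⊥-elim)
open import Function.Definitions using (Injective)
open import Relation.Binary.Definitions using (tri<; tri≈; tri>)
open import Relation.Binary.PropositionalEquality using (_≡_; _≢_; refl; sym; cong; cong₂)
open import Relation.Nullary using (¬_; Dec; yes; no; ¬?)
open import Relation.Nullary.Decidable using (_×-dec_)

private
  variable
    k n : ℕ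

unique⇒lookup-injective : ∀ {A : Set} {xs : List A} → Unique xs →
                          ∀ i j → lookup xs i ≡ lookup xs j → i ≡ j
unique⇒lookup-injective (_ ∷ _)       fzero    fzero    _ = refl
unique⇒lookup-injective (x≢xs ∷ _)    fzero    (fsuc j) e = ⊥-elim (All.lookup x≢xs (∈-lookup j) e)
unique⇒lookup-injective (x≢xs ∷ _)    (fsuc i) fzero    e = ⊥-elim (All.lookup x≢xs (∈-lookup i) (sym e))
unique⇒lookup-injective (_ ∷ unique) (fsuc i) (fsuc j) e = cong fsuc (unique⇒lookup-injective unique i j e)

SameEndpoints : ∀ {A : Set} → A × A → A × A → Set
SameEndpoints (a , b) (c , d) = (a ≡ c × b ≡ d) ⊎ (a ≡ d × b ≡ c)

sameEndpoints-reflect : ∀ {A B : Set} {f : A → B} → Injective _≡_ _≡_ f →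
                        ∀ {a b c d} → SameEndpoints (f a , f b) (f c , f d) → SameEndpoints (a , b) (c , d)
sameEndpoints-reflect f-inj (inj₁ (ac , bd)) = inj₁ (f-inj ac , f-inj bd)
sameEndpoints-reflect f-inj (inj₂ (ad , bc)) = inj₂ (f-inj ad , f-inj bc)

increasing-sameEndpoints : ∀ {p q : Fin n × Fin n} → proj₁ p < proj₂ p → proj₁ q < proj₂ q →
                           SameEndpoints p q → p ≡ q
increasing-sameEndpoints _   _   (inj₁ (ac , bd)) = cong₂ _,_ ac bd
increasing-sameEndpoints a<b c<d (inj₂ (refl , refl)) = ⊥-elim (<-asym a<b c<d)

PairIn : Fin n × Fin n → Subset n → Set
PairIn (a , b) h = a ∈ h × b ∈ h

Represents : List (Fin n × Fin n) → Hypergraph n → Set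
Represents = Pointwise PairIn

represented : ∀ {P} {H : Hypergraph n} → Represents P H → ∀ {p} → p ∈ₗ P → Fin (length H)
represented (_ ∷ _) (here _)  = fzero
represented (_ ∷ r) (there m) = fsuc (represented r m)

represented-⊇ : ∀ {P} {H : Hypergraph n} (r : Represents P H) → ∀ {p} (m : p ∈ₗ P) → PairIn p (lookup H (represented r m))
represented-⊇ (p⊆h ∷ _) (here refl) = p⊆h
represented-⊇ (_ ∷ r)   (there m)   = represented-⊇ r m

represented-injective : ∀ {P} {H : Hypergraph n} (r : Represents P H) → ∀ {p q} (m : p ∈ₗ P) (m′ : q ∈ₗ P) →
                        represented r m ≡ represented r m′ → p ≡ q
represented-injective (_ ∷ _) (here refl) (here refl) _  = refl
represented-injective (_ ∷ r) (there m)   (there m′)  eq = represented-injective r m m′ (suc-injective eq)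

module _ (G : Graph n) {H : Hypergraph n} (r : Represents (edges G) H) where

  representedBy : ∀ {a b} → Adj G a b → Fin (length H)
  representedBy (inj₁ m) = represented r m
  representedBy (inj₂ m) = represented r m

  representedBy-⊇ : ∀ {a b} (α : Adj G a b) → PairIn (a , b) (lookup H (representedBy α))
  representedBy-⊇ (inj₁ m) = represented-⊇ r m
  representedBy-⊇ (inj₂ m) = let (b∈ , a∈) = represented-⊇ r m in a∈ , b∈

  representedBy-injective : ∀ {a b c d} (α : Adj G a b) (β : Adj G c d) →
                            representedBy α ≡ representedBy β → SameEndpoints (a , b) (c , d)
  representedBy-injective (inj₁ m) (inj₁ m′) eq with represented-injective r m m′ eq
  ... | refl = inj₁ (refl , refl)
  representedBy-injective (inj₁ m) (inj₂ m′) eq with represented-injective r m m′ eq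
  ... | refl = inj₂ (refl , refl)
  representedBy-injective (inj₂ m) (inj₁ m′) eq with represented-injective r m m′ eq
  ... | refl = inj₂ (refl , refl)
  representedBy-injective (inj₂ m) (inj₂ m′) eq with represented-injective r m m′ eq
  ... | refl = inj₁ (refl , refl)

  copy⇒berge : (F : Graph k) → ContainsCopy G F → ContainsBerge H F
  copy⇒berge F (φ , φ-inj , adjacent) = φ , g , φ-inj , g-inj , g-⊇
    where
    edgeF : Fin (length (edges F)) → Fin _ × Fin _
    edgeF i = lookup (edges F) i

    image-adjacent : ∀ i → Adj G (φ (proj₁ (edgeF i))) (φ (proj₂ (edgeF i)))
    image-adjacent i = All.lookup adjacent (∈-lookup i)

    g : Fin (length (edges F)) → Fin (length H)
    g i = representedBy (image-adjacent i)

    g-⊇ : ∀ i → PairIn (φ (proj₁ (edgeF i)) , φ (proj₂ (edgeF i))) (lookup H (g i))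
    g-⊇ i = representedBy-⊇ (image-adjacent i)

    g-inj : Injective _≡_ _≡_ g
    g-inj {i} {j} eq =
      unique⇒lookup-injective (distinct F) i j
        (increasing-sameEndpoints (All.lookup (ordered F) (∈-lookup i)) (All.lookup (ordered F) (∈-lookup j))
          (sameEndpoints-reflect φ-inj
            (representedBy-injective (image-adjacent i) (image-adjacent j) eq)))

berge-weaken : (F : Graph k) {h : Subset n} {H : Hypergraph n} → ContainsBerge H F → ContainsBerge (h ∷ H) F
berge-weaken F (φ , g , φ-inj , g-inj , g-⊇) = φ , (λ i → fsuc (g i)) , φ-inj , (λ eq → g-inj (suc-injective eq)) , g-⊇

enumerate : (h : Subset n) → Fin ∣ h ∣ → Fin n
enumerate (inside ∷ h)  fzero    = fzero
enumerate (inside ∷ h)  (fsuc i) = fsuc (enumerate h i)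
enumerate (outside ∷ h) i        = fsuc (enumerate h i)

enumerate-∈ : (h : Subset n) → ∀ i → enumerate h i ∈ h
enumerate-∈ (inside ∷ h)  fzero    = here
enumerate-∈ (inside ∷ h)  (fsuc i) = there (enumerate-∈ h i)
enumerate-∈ (outside ∷ h) i        = there (enumerate-∈ h i)

enumerate-injective : (h : Subset n) → Injective _≡_ _≡_ (enumerate h)
enumerate-injective (inside ∷ h)  {fzero}  {fzero}  _  = refl
enumerate-injective (inside ∷ h)  {fsuc i} {fsuc j} eq = cong fsuc (enumerate-injective h (suc-injective eq))
enumerate-injective (outside ∷ h) eq = enumerate-injective h (suc-injective eq)

Clique : Graph n → Subset n → Set
Clique {n} G h = ∀ {x y : Fin n} → x ∈ h → y ∈ h → x ≢ y → Adj G x y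

clique⇒copy : (F : Graph k) (G : Graph n) (h : Subset n) → k ≤ ∣ h ∣ → Clique G h → ContainsCopy G F
clique⇒copy F G h k≤∣h∣ clique = φ , φ-inj , All.tabulate adjacent
  where
  φ : Fin _ → Fin _
  φ i = enumerate h (inject≤ i k≤∣h∣)

  φ-inj : Injective _≡_ _≡_ φ
  φ-inj eq = inject≤-injective k≤∣h∣ k≤∣h∣ _ _ (enumerate-injective h eq)

  adjacent : ∀ {ab} → ab ∈ₗ edges F → Adj G (φ (proj₁ ab)) (φ (proj₂ ab))
  adjacent m = clique (enumerate-∈ h _) (enumerate-∈ h _)
                 (λ eq → <-irrefl (φ-inj eq) (All.lookup (ordered F) m))

NewPair : Graph n → Subset n → Set
NewPair {n} G h = ∃ λ (x : Fin n) → ∃ λ y → x ∈ h × y ∈ h × x < y × ¬ ((x , y) ∈ₗ edges G)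

addEdge : (G : Graph n) (h : Subset n) → NewPair G h → Graph n
addEdge G h (x , y , _ , _ , x<y , new) = record
  { edges    = (x , y) ∷ edges G
  ; ordered  = x<y ∷ ordered G
  ; distinct = ¬Any⇒All¬ (edges G) new ∷ distinct G
  }

isEdge? : (G : Graph n) (p : Fin n × Fin n) → Dec (p ∈ₗ edges G)
isEdge? G p = member? (≡-dec _≟ᶠ_ _≟ᶠ_) p (edges G)

newPair-or-clique : (G : Graph n) (h : Subset n) → NewPair G h ⊎ Clique G h
newPair-or-clique G h with any? (λ x → any? (λ y → new? x y))
  where
  new? : ∀ x y → Dec (x ∈ h × y ∈ h × x < y × ¬ ((x , y) ∈ₗ edges G))
  new? x y = (x ∈ˢ? h) ×-dec (y ∈ˢ? h) ×-dec (x <? y) ×-dec ¬? (isEdge? G (x , y))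
... | yes newPair = inj₁ newPair
... | no noNewPair = inj₂ clique
  where
  edge : ∀ {x y} → x ∈ h → y ∈ h → x < y → (x , y) ∈ₗ edges G
  edge {x} {y} x∈ y∈ x<y with isEdge? G (x , y)
  ... | yes m   = m
  ... | no  new = ⊥-elim (noNewPair (x , y , x∈ , y∈ , x<y , new))

  clique : Clique G h
  clique {x} {y} x∈ y∈ x≢y with <-cmp x y
  ... | tri< x<y _ _ = inj₁ (edge x∈ y∈ x<y)
  ... | tri≈ _ x≡y _ = ⊥-elim (x≢y x≡y)
  ... | tri> _ _ y<x = inj₂ (edge y∈ x∈ y<x)

representingGraph : (F : Graph k) (H : Hypergraph n) → BergeFree F H → All (λ h → k ≤ ∣ h ∣) H →
                    Σ (Graph n) λ G → Represents (edges G) H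
representingGraph F []      _    []             = record { edges = [] ; ordered = [] ; distinct = [] } , []
representingGraph F (h ∷ H) free (k≤∣h∣ ∷ large)
  with representingGraph F H (λ berge → free (berge-weaken F berge)) large
... | G , r with newPair-or-clique G h
...   | inj₁ new@(_ , _ , x∈ , y∈ , _) = addEdge G h new , (x∈ , y∈) ∷ r
...   | inj₂ clique = ⊥-elim (free (berge-weaken F (copy⇒berge G r F (clique⇒copy F G h k≤∣h∣ clique))))

lemma1 : (k : ℕ) (F : Graph k) (n : ℕ) (H : Hypergraph n) →
         BergeFree F H →
         All (λ h → k ≤ ∣ h ∣) H →
         length H ≤ex[ n , F ]
lemma1 k F n H free large = G , G-free , |H|≤e[G]
  where
  G : Graph n
  G = proj₁ (representingGraph F H free large)

  r : Represents (edges G) H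
  r = proj₂ (representingGraph F H free large)

  G-free : FFree F G
  G-free copy = free (copy⇒berge G r F copy)

  |H|≤e[G] : length H ≤ e G
  |H|≤e[G] = ≤-reflexive (sym (Pointwise-length r))
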